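{- Let $S\subset\mathbb{N}$ be finite with $|S|=n$. If Maker has an $n$-move strategy in the game for $S$, then $S$ is symmetric.
   Context: Game for $S$: for a fixed finite set $S\subset\mathbb{N}$, two players, Maker and Breaker, alternately choose previously unchosen natural numbers, Maker choosing first. Maker wins as soon as the set of Maker's choices contains $aS+b$ for some $a\in\mathbb{N}\setminus\{0\}$ and $b\in\mathbb{Z}$. Maker has an $N$-move strategy if Maker has a strategy guaranteeing a win using at most $N$ selections, whatever Breaker does. For $R,R'\subset\mathbb{Q}$, $R'$ is a copy of $R$ if $R'=aR+b$ for some rational $a>0$ and rational $b$. Write $S=\{s_1<s_2<\dots<s_n\}$. $S$ is symmetric if there exist $1\le i<j\le n$ such that $S\setminus\{s_i\}$ is a copy of $S\setminus\{s_j\}$; then $S$ has symmetry type $(i,j)$. -}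

module Defs where

open import Data.Nat as ℕ using (ℕ; zero; suc; _≤_)
open import Data.Integer as ℤ using (ℤ; +_)
open import Data.Rational as ℚ using (ℚ; Positive)
open import Data.Fin using (Fin)
import Data.Fin as Fin
open import Data.List using (List; []; _∷_; length; removeAt; map)
open import Data.List.Membership.Propositional using (_∈_; _∉_)
open import Data.Product using (Σ; ∃; ∃-syntax; _×_; _,_)
open import Data.Sum using (_⊎_)
open import Function.Bundles using (_⇔_)
open import Relation.Binary.PropositionalEquality using (_≡_; _≢_)

ContainsCopy : List ℕ → List ℕ → Set
ContainsCopy S M =
  Σ ℕ λ a → 1 ≤ a × Σ ℤ λ b →
    ∀ s → s ∈ S → Σ ℕ λ m → m ∈ M × (+ m ≡ (+ (a ℕ.* s)) ℤ.+ b)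

-- MakerWins S k M B : with Maker's set M and Breaker's set B, Maker to move,
-- Maker has a strategy guaranteeing a win using at most k further selections.
MakerWins : List ℕ → ℕ → List ℕ → List ℕ → Set
MakerWins S zero    M B = ContainsCopy S M
MakerWins S (suc k) M B =
  ContainsCopy S M ⊎
  Σ ℕ λ x → x ∉ M × x ∉ B ×
    (∀ y → y ≢ x → y ∉ M → y ∉ B → MakerWins S k (x ∷ M) (y ∷ B))

HasStrategy : List ℕ → ℕ → Set
HasStrategy S N = MakerWins S N [] []

toℚ : ℕ → ℚ
toℚ n = (+ n) ℚ./ 1

IsCopy : List ℕ → List ℕ → Set
IsCopy R' R = Σ ℚ λ a → Positive a × Σ ℚ λ b →
  ∀ q → (q ∈ map toℚ R') ⇔ (q ∈ map (λ r → a ℚ.* toℚ r ℚ.+ b) R)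

-- S (given as strictly increasing list s₁ < … < sₙ) is symmetric:
-- some i < j with S ∖ {sᵢ} a copy of S ∖ {sⱼ}.
Symmetric : List ℕ → Set
Symmetric S = Σ (Fin (length S)) λ i → Σ (Fin (length S)) λ j →
  (i Fin.< j) × IsCopy (removeAt S i) (removeAt S j)

-- Breaker answers every selection of Maker with a number nobody has chosen yet. A copy of S
-- has |S| elements, so Maker cannot win before his |S|-th selection; hence, holding a set T
-- of |S| - 1 numbers, Maker has two different winning moves x ≠ x'. Counting shows that
-- x ∷ T is then exactly the image f(S) of an increasing affine map f with f(sᵢ) = x, so
-- f(S ∖ sᵢ) = T, and likewise g(S ∖ sⱼ) = T with g(sⱼ) = x'. If i ≠ j, then f⁻¹ ∘ g maps
-- S ∖ sⱼ onto S ∖ sᵢ. If i = j, the increasing affine maps f and g have the same image of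
-- S ∖ sᵢ, a set with at least two elements, so f = g and x = x'. For |S| = 2 both sets
-- S ∖ sᵢ are singletons.
module Submission where

open import Defs
open import Data.Fin using (Fin; zero; suc)
import Data.Fin.Properties as Finₚ
open import Data.Integer as ℤ using (ℤ; +_)
import Data.Integer.Properties as ℤₚ
open import Algebra.Properties.AbelianGroup ℤₚ.+-0-abelianGroup
  using () renaming (∙-cancelˡ to +-cancelˡ)
open import Algebra.Properties.CommutativeSemigroup ℤₚ.+-commutativeSemigroup
  using () renaming (xy∙z≈xz∙y to +-right-comm)
open import Data.Integer.Tactic.RingSolver using (solve-∀)
open import Data.List using (List; []; _∷_; [_]; _++_; length; lookup; map; removeAt)
open import Data.List.Extrema.Nat using (max; xs≤max)
open import Data.List.Membership.Propositional using (_∈_; _∉_; lose)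
import Data.List.Membership.DecPropositional as DecMembership
open import Data.List.Membership.Propositional.Properties
  using (∈-map⁺; ∈-map⁻; ∈-lookup; ∈-++⁺ˡ; ∈-++⁺ʳ)
open import Data.List.Properties using (length-map; length-removeAt′)
open import Data.List.Relation.Binary.Subset.Propositional using (_⊆_)
import Data.List.Relation.Binary.Subset.Propositional.Properties as ⊆
open ⊆ using (⊆-trans)
open import Data.List.Relation.Unary.All as All using (All; _∷_)
open import Data.List.Relation.Unary.All.Properties using (¬Any⇒All¬)
open import Data.List.Relation.Unary.AllPairs as AllPairs using (AllPairs; _∷_)
open import Data.List.Relation.Unary.Any as Any using (here; there; any?)
open import Data.List.Relation.Unary.Any.Properties using (lookup-index)
open import Data.List.Relation.Unary.Unique.Propositional using (Unique)
import Data.List.Relation.Unary.Unique.Propositional.Properties as Unique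
open import Data.Nat as ℕ using (ℕ; zero; suc; _+_; _*_; _≤_; _<_; s≤s; z≤n; z<s)
import Data.Nat.Properties as ℕₚ
open import Data.Product using (∃; _×_; _,_; proj₂)
open import Function using (_∘_)
open import Data.Rational as ℚ using (ℚ; _/_; 1ℚ)
import Data.Rational.Properties as ℚₚ
open import Data.Rational.Solver using (module +-*-Solver)
open import Data.Rational.Unnormalised as ℚᵘ using (mkℚᵘ; *≡*)
import Data.Rational.Unnormalised.Properties as ℚᵘₚ
open import Data.Sum using (inj₁; inj₂)
open import Function.Bundles using (mk⇔)
open import Relation.Binary.Core using (_Preserves_⟶_)
open import Relation.Binary.Definitions using (DecidableEquality; tri<; tri≈; tri>)
open import Relation.Binary.PropositionalEquality
  using (_≡_; _≢_; refl; sym; trans; cong; cong₂; subst; subst₂; module ≡-Reasoning)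
open import Relation.Nullary using (yes; no; contradiction)

module _ {A : Set} where

  removeAt-⊆ : (xs : List A) (i : Fin (length xs)) → removeAt xs i ⊆ xs
  removeAt-⊆ (x ∷ xs) zero    z∈           = there z∈
  removeAt-⊆ (x ∷ xs) (suc i) (here z≡x)   = here z≡x
  removeAt-⊆ (x ∷ xs) (suc i) (there z∈)   = there (removeAt-⊆ xs i z∈)

  ∈-removeAt⁺ : ∀ {z} (xs : List A) i → z ∈ xs → z ≢ lookup xs i → z ∈ removeAt xs i
  ∈-removeAt⁺ (x ∷ xs) zero    (here z≡x) z≢x = contradiction z≡x z≢x
  ∈-removeAt⁺ (x ∷ xs) zero    (there z∈) _   = z∈
  ∈-removeAt⁺ (x ∷ xs) (suc i) (here z≡x) _   = here z≡x
  ∈-removeAt⁺ (x ∷ xs) (suc i) (there z∈) z≢  = there (∈-removeAt⁺ xs i z∈ z≢)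

  All-removeAt : ∀ {P : A → Set} (xs : List A) i → All P xs → All P (removeAt xs i)
  All-removeAt (x ∷ xs) zero    (_ ∷ pxs)  = pxs
  All-removeAt (x ∷ xs) (suc i) (px ∷ pxs) = px ∷ All-removeAt xs i pxs

  AllPairs-removeAt : ∀ {R : A → A → Set} (xs : List A) i → AllPairs R xs → AllPairs R (removeAt xs i)
  AllPairs-removeAt (x ∷ xs) zero    (_ ∷ pxs)  = pxs
  AllPairs-removeAt (x ∷ xs) (suc i) (px ∷ pxs) = All-removeAt xs i px ∷ AllPairs-removeAt xs i pxs

  Unique-removeAt⇒≢lookup : ∀ {z} (xs : List A) i → Unique xs → z ∈ removeAt xs i → z ≢ lookup xs i
  Unique-removeAt⇒≢lookup (x ∷ xs) zero    (x≢xs ∷ _) z∈ z≡x = All.lookup x≢xs z∈ (sym z≡x)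
  Unique-removeAt⇒≢lookup (x ∷ xs) (suc i) (x≢xs ∷ _) (here refl) = All.lookup x≢xs (∈-lookup i)
  Unique-removeAt⇒≢lookup (x ∷ xs) (suc i) (_ ∷ unique) (there z∈) =
    Unique-removeAt⇒≢lookup xs i unique z∈

  unique-⊆⇒length-≤ : ∀ {xs ys : List A} → Unique xs → xs ⊆ ys → length xs ≤ length ys
  unique-⊆⇒length-≤ {[]}     _                  _     = z≤n
  unique-⊆⇒length-≤ {x ∷ xs} {ys} (x≢xs ∷ unique) xs⊆ys =
    subst (suc (length xs) ≤_) (sym (length-removeAt′ ys k))
      (s≤s (unique-⊆⇒length-≤ unique xs⊆ys-x))
    where
    x∈ys : x ∈ ys
    x∈ys = xs⊆ys (here refl)
    k : Fin (length ys)
    k = Any.index x∈ys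
    xs⊆ys-x : xs ⊆ removeAt ys k
    xs⊆ys-x z∈xs = ∈-removeAt⁺ ys k (xs⊆ys (there z∈xs))
      λ z≡ → All.lookup x≢xs z∈xs (trans (lookup-index x∈ys) (sym z≡))

  module _ (_≟_ : DecidableEquality A) where
    open DecMembership _≟_ using (_∈?_)

    unique-⊆-length-≥⇒⊇ : ∀ {xs ys : List A} → Unique xs → xs ⊆ ys → length ys ≤ length xs →
                          ys ⊆ xs
    unique-⊆-length-≥⇒⊇ {xs} {ys} unique xs⊆ys ys≤xs {z} z∈ys with z ∈? xs
    ... | yes z∈xs = z∈xs
    ... | no  z∉xs = contradiction ys≤xs
                       (ℕₚ.<⇒≱ (unique-⊆⇒length-≤ (¬Any⇒All¬ xs z∉xs ∷ unique) z∷xs⊆ys))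
      where
      z∷xs⊆ys : z ∷ xs ⊆ ys
      z∷xs⊆ys (here refl) = z∈ys
      z∷xs⊆ys (there w∈)  = xs⊆ys w∈

sorted⇒unique : ∀ {xs} → AllPairs _<_ xs → Unique xs
sorted⇒unique = AllPairs.map ℕₚ.<⇒≢

strictlyIncreasing⇒injective : ∀ {F : ℕ → ℤ} → F Preserves _<_ ⟶ ℤ._<_ →
                               ∀ {s s'} → F s ≡ F s' → s ≡ s'
strictlyIncreasing⇒injective {F} F↑ {s} {s'} Fs≡Fs' with ℕₚ.<-cmp s s'
... | tri< s<s' _ _ = contradiction (F↑ s<s') (ℤₚ.<-irrefl Fs≡Fs')
... | tri≈ _ s≡s' _ = s≡s'
... | tri> _ _ s'<s = contradiction (F↑ s'<s) (ℤₚ.<-irrefl (sym Fs≡Fs'))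

least-image : ∀ {G : ℕ → ℤ} {u R z} → G Preserves _<_ ⟶ ℤ._<_ → All (u <_) R →
              z ∈ map G (u ∷ R) → G u ℤ.≤ z
least-image G↑ u<R (here refl) = ℤₚ.≤-refl
least-image G↑ u<R (there z∈) with s , s∈R , refl ← ∈-map⁻ _ z∈ =
  ℤₚ.<⇒≤ (G↑ (All.lookup u<R s∈R))

drop-least-image : ∀ {F G : ℕ → ℤ} {u R} → F Preserves _<_ ⟶ ℤ._<_ → All (u <_) R → F u ≡ G u →
                   map F (u ∷ R) ⊆ map G (u ∷ R) → map F R ⊆ map G R
drop-least-image {F} F↑ u<R Fu≡Gu F⊆G z∈ with s , s∈R , refl ← ∈-map⁻ F z∈ with F⊆G (there z∈)
... | here Fs≡Gu  =
  contradiction (F↑ (All.lookup u<R s∈R)) (ℤₚ.<-irrefl (sym (trans Fs≡Gu (sym Fu≡Gu))))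
... | there Fs∈GR = Fs∈GR

same-image⇒agree : ∀ {F G : ℕ → ℤ} → F Preserves _<_ ⟶ ℤ._<_ → G Preserves _<_ ⟶ ℤ._<_ →
                   ∀ {R} → AllPairs _<_ R → map F R ⊆ map G R → map G R ⊆ map F R →
                   ∀ {s} → s ∈ R → F s ≡ G s
same-image⇒agree {F} {G} F↑ G↑ {u ∷ R} (u<R ∷ sorted) F⊆G G⊆F = λ
  { (here refl)  → Fu≡Gu
  ; (there s∈R) → same-image⇒agree F↑ G↑ sorted
      (drop-least-image F↑ u<R Fu≡Gu F⊆G) (drop-least-image G↑ u<R (sym Fu≡Gu) G⊆F) s∈R
  }
  where
  Fu≡Gu : F u ≡ G u
  Fu≡Gu = ℤₚ.≤-antisym (least-image F↑ u<R (G⊆F (here refl))) (least-image G↑ u<R (F⊆G (here refl)))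

record Affine : Set where
  constructor affine
  field
    slope-1 : ℕ
    shift   : ℤ

  slope : ℕ
  slope = suc slope-1

open Affine

⟦_⟧ : Affine → ℕ → ℤ
⟦ f ⟧ s = + (slope f * s) ℤ.+ shift f

⟦⟧-mono-< : ∀ f → ⟦ f ⟧ Preserves _<_ ⟶ ℤ._<_
⟦⟧-mono-< f s<s' = ℤₚ.+-monoˡ-< (shift f) (ℤ.+<+ (ℕₚ.*-monoʳ-< (slope f) s<s'))

⟦⟧-injective : ∀ f {s s'} → ⟦ f ⟧ s ≡ ⟦ f ⟧ s' → s ≡ s'
⟦⟧-injective f = strictlyIncreasing⇒injective (⟦⟧-mono-< f)

⟦⟧-+ : ∀ f s k → ⟦ f ⟧ (s + k) ≡ ⟦ f ⟧ s ℤ.+ + (slope f * k)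
⟦⟧-+ f s k = begin
  + (slope f * (s + k)) ℤ.+ b                  ≡⟨ cong (λ n → + n ℤ.+ b) (ℕₚ.*-distribˡ-+ (slope f) s k) ⟩
  (+ (slope f * s) ℤ.+ + (slope f * k)) ℤ.+ b  ≡⟨ +-right-comm (+ (slope f * s)) (+ (slope f * k)) b ⟩
  + (slope f * s) ℤ.+ b ℤ.+ + (slope f * k)    ∎
  where
  open ≡-Reasoning
  b : ℤ
  b = shift f

⟦⟧-rigid : ∀ {f g u v} → u < v → ⟦ f ⟧ u ≡ ⟦ g ⟧ u → ⟦ f ⟧ v ≡ ⟦ g ⟧ v → f ≡ g
⟦⟧-rigid {f} {g} {u} u<v fu≡gu fv≡gv with k , refl ← ℕₚ.m≤n⇒∃[o]m+o≡n u<v =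
  cong₂ affine slope-1≡ shift≡
  where
  open ≡-Reasoning
  v : ℕ
  v = u + suc k
  agree-at-v : ⟦ f ⟧ v ≡ ⟦ g ⟧ v
  agree-at-v = subst (λ w → ⟦ f ⟧ w ≡ ⟦ g ⟧ w) (sym (ℕₚ.+-suc u k)) fv≡gv
  increments : + (slope f * suc k) ≡ + (slope g * suc k)
  increments = +-cancelˡ (⟦ f ⟧ u) _ _ (begin
    ⟦ f ⟧ u ℤ.+ + (slope f * suc k)   ≡⟨ sym (⟦⟧-+ f u (suc k)) ⟩
    ⟦ f ⟧ v                          ≡⟨ agree-at-v ⟩
    ⟦ g ⟧ v                          ≡⟨ ⟦⟧-+ g u (suc k) ⟩
    ⟦ g ⟧ u ℤ.+ + (slope g * suc k)   ≡⟨ cong (ℤ._+ _) (sym fu≡gu) ⟩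
    ⟦ f ⟧ u ℤ.+ + (slope g * suc k)   ∎)
  slope-1≡ : slope-1 f ≡ slope-1 g
  slope-1≡ = ℕₚ.suc-injective
    (ℕₚ.*-cancelʳ-≡ (slope f) (slope g) (suc k) (ℤₚ.+-injective increments))
  shift≡ : shift f ≡ shift g
  shift≡ = +-cancelˡ (+ (slope f * u)) _ _
    (trans fu≡gu (cong (λ a → + (suc a * u) ℤ.+ shift g) (sym slope-1≡)))

⟦⟧-same-image⇒≡ : ∀ f g {R} → AllPairs _<_ R → 2 ≤ length R →
                  map ⟦ f ⟧ R ⊆ map ⟦ g ⟧ R → map ⟦ g ⟧ R ⊆ map ⟦ f ⟧ R → f ≡ g
⟦⟧-same-image⇒≡ f g {_ ∷ []} _ (s≤s ()) _ _
⟦⟧-same-image⇒≡ f g {u ∷ v ∷ R} sorted@((u<v ∷ _) ∷ _) _ f⊆g g⊆f =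
  ⟦⟧-rigid u<v (agree (here refl)) (agree (there (here refl)))
  where
  agree : ∀ {s} → s ∈ u ∷ v ∷ R → ⟦ f ⟧ s ≡ ⟦ g ⟧ s
  agree = same-image⇒agree (⟦⟧-mono-< f) (⟦⟧-mono-< g) sorted f⊆g g⊆f

affine-inverseᵘ : ∀ a-1 c s r b d → + (suc a-1 * s) ℤ.+ b ≡ + (c * r) ℤ.+ d →
  mkℚᵘ (+ s) 0 ℚᵘ.≃ mkℚᵘ (+ c) a-1 ℚᵘ.* mkℚᵘ (+ r) 0 ℚᵘ.+ mkℚᵘ (d ℤ.- b) a-1
affine-inverseᵘ a-1 c s r b d as+b≡cr+d = *≡* (begin
  + s ℤ.* + (a * 1 * a)   ≡⟨ cong (λ n → + s ℤ.* + (n * a)) (ℕₚ.*-identityʳ a) ⟩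
  + s ℤ.* + (a * a)       ≡⟨ cong (+ s ℤ.*_) (ℤₚ.pos-* a a) ⟩
  + s ℤ.* (+ a ℤ.* + a)   ≡⟨ cross (+ s) (+ a) (+ c) (+ r) b d as+b≡cr+d' ⟩
  (+ c ℤ.* + r ℤ.* + a ℤ.+ (d ℤ.- b) ℤ.* + a) ℤ.* + 1
                          ≡⟨ cong (λ n → (+ c ℤ.* + r ℤ.* + a ℤ.+ (d ℤ.- b) ℤ.* + n) ℤ.* + 1)
                                  (sym (ℕₚ.*-identityʳ a)) ⟩
  (+ c ℤ.* + r ℤ.* + a ℤ.+ (d ℤ.- b) ℤ.* + (a * 1)) ℤ.* + 1 ∎)
  where
  open ≡-Reasoning
  a : ℕ
  a = suc a-1
  as+b≡cr+d' : + a ℤ.* + s ℤ.+ b ≡ + c ℤ.* + r ℤ.+ d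
  as+b≡cr+d' = subst₂ (λ x y → x ℤ.+ b ≡ y ℤ.+ d) (ℤₚ.pos-* a s) (ℤₚ.pos-* c r) as+b≡cr+d
  cross : ∀ S A C R b d → A ℤ.* S ℤ.+ b ≡ C ℤ.* R ℤ.+ d →
          S ℤ.* (A ℤ.* A) ≡ (C ℤ.* R ℤ.* A ℤ.+ (d ℤ.- b) ℤ.* A) ℤ.* + 1
  cross S A C R b d h = begin
    S ℤ.* (A ℤ.* A)                             ≡⟨ unshift S A b ⟩
    (A ℤ.* S ℤ.+ b ℤ.- b) ℤ.* A                 ≡⟨ cong (λ z → (z ℤ.- b) ℤ.* A) h ⟩
    (C ℤ.* R ℤ.+ d ℤ.- b) ℤ.* A                 ≡⟨ distribute C R A b d ⟩
    (C ℤ.* R ℤ.* A ℤ.+ (d ℤ.- b) ℤ.* A) ℤ.* + 1  ∎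
    where
    unshift : ∀ S A b → S ℤ.* (A ℤ.* A) ≡ (A ℤ.* S ℤ.+ b ℤ.- b) ℤ.* A
    unshift = solve-∀
    distribute : ∀ C R A b d →
                 (C ℤ.* R ℤ.+ d ℤ.- b) ℤ.* A ≡ (C ℤ.* R ℤ.* A ℤ.+ (d ℤ.- b) ℤ.* A) ℤ.* + 1
    distribute = solve-∀

affine-inverse : ∀ a-1 c s r b d → + (suc a-1 * s) ℤ.+ b ≡ + (c * r) ℤ.+ d →
  toℚ s ≡ (+ c / suc a-1) ℚ.* toℚ r ℚ.+ (d ℤ.- b) / suc a-1
affine-inverse a-1 c s r b d as+b≡cr+d = ℚₚ.toℚᵘ-injective (begin
  ℚ.toℚᵘ (toℚ s)
    ≈⟨ ℚₚ.toℚᵘ-fromℚᵘ (mkℚᵘ (+ s) 0) ⟩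
  mkℚᵘ (+ s) 0
    ≈⟨ affine-inverseᵘ a-1 c s r b d as+b≡cr+d ⟩
  mkℚᵘ (+ c) a-1 ℚᵘ.* mkℚᵘ (+ r) 0 ℚᵘ.+ mkℚᵘ (d ℤ.- b) a-1
    ≈⟨ ℚᵘₚ.+-cong (ℚᵘₚ.*-cong (normalised (+ c) a-1) (normalised (+ r) 0)) (normalised (d ℤ.- b) a-1) ⟩
  ℚ.toℚᵘ α ℚᵘ.* ℚ.toℚᵘ (toℚ r) ℚᵘ.+ ℚ.toℚᵘ β
    ≈⟨ ℚᵘₚ.+-cong (ℚᵘₚ.≃-sym (ℚₚ.toℚᵘ-homo-* α (toℚ r))) ℚᵘₚ.≃-refl ⟩
  ℚ.toℚᵘ (α ℚ.* toℚ r) ℚᵘ.+ ℚ.toℚᵘ β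
    ≈⟨ ℚᵘₚ.≃-sym (ℚₚ.toℚᵘ-homo-+ (α ℚ.* toℚ r) β) ⟩
  ℚ.toℚᵘ (α ℚ.* toℚ r ℚ.+ β)
    ∎)
  where
  open ℚᵘₚ.≃-Reasoning
  α β : ℚ
  α = + c / suc a-1
  β = (d ℤ.- b) / suc a-1
  normalised : ∀ n d-1 → mkℚᵘ n d-1 ℚᵘ.≃ ℚ.toℚᵘ (ℚ.fromℚᵘ (mkℚᵘ n d-1))
  normalised n d-1 = ℚᵘₚ.≃-sym (ℚₚ.toℚᵘ-fromℚᵘ (mkℚᵘ n d-1))

matching⇒isCopy : ∀ {R' R} (a : ℚ) → ℚ.Positive a → (b : ℚ) →
  (∀ {s} → s ∈ R' → ∃ λ r → r ∈ R × toℚ s ≡ a ℚ.* toℚ r ℚ.+ b) →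
  (∀ {r} → r ∈ R → ∃ λ s → s ∈ R' × toℚ s ≡ a ℚ.* toℚ r ℚ.+ b) →
  IsCopy R' R
matching⇒isCopy {R'} {R} a a>0 b forward backward = a , a>0 , b , λ q → mk⇔ to from
  where
  g : ℕ → ℚ
  g r = a ℚ.* toℚ r ℚ.+ b
  to : ∀ {q} → q ∈ map toℚ R' → q ∈ map g R
  to q∈ with s , s∈ , refl ← ∈-map⁻ toℚ q∈ with r , r∈ , s≡gr ← forward s∈ =
    subst (_∈ map g R) (sym s≡gr) (∈-map⁺ g r∈)
  from : ∀ {q} → q ∈ map g R → q ∈ map toℚ R'
  from q∈ with r , r∈ , refl ← ∈-map⁻ g q∈ with s , s∈ , s≡gr ← backward r∈ =
    subst (_∈ map toℚ R') s≡gr (∈-map⁺ toℚ s∈)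

isCopy-singleton : ∀ s r → IsCopy [ s ] [ r ]
isCopy-singleton s r = matching⇒isCopy 1ℚ _ (toℚ s ℚ.- toℚ r)
  (λ { (here refl) → r , here refl , translation })
  (λ { (here refl) → s , here refl , translation })
  where
  open +-*-Solver
  translation : toℚ s ≡ 1ℚ ℚ.* toℚ r ℚ.+ (toℚ s ℚ.- toℚ r)
  translation = solve 2 (λ x y → x := con 1ℚ :* y :+ (x :- y)) refl (toℚ s) (toℚ r)

same-affine-image⇒isCopy : ∀ f g {R' R} → map ⟦ f ⟧ R' ⊆ map ⟦ g ⟧ R → map ⟦ g ⟧ R ⊆ map ⟦ f ⟧ R' →
                           IsCopy R' R
same-affine-image⇒isCopy f g {R'} {R} f⊆g g⊆f =
  matching⇒isCopy α (ℚₚ.normalize-pos (slope g) (slope f)) β forward backward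
  where
  α β : ℚ
  α = + slope g / slope f
  β = (shift g ℤ.- shift f) / slope f
  inverse : ∀ {s r} → ⟦ f ⟧ s ≡ ⟦ g ⟧ r → toℚ s ≡ α ℚ.* toℚ r ℚ.+ β
  inverse {s} {r} = affine-inverse (slope-1 f) (slope g) s r (shift f) (shift g)
  forward : ∀ {s} → s ∈ R' → ∃ λ r → r ∈ R × toℚ s ≡ α ℚ.* toℚ r ℚ.+ β
  forward s∈ with r , r∈ , fs≡gr ← ∈-map⁻ ⟦ g ⟧ (f⊆g (∈-map⁺ ⟦ f ⟧ s∈)) =
    r , r∈ , inverse fs≡gr
  backward : ∀ {r} → r ∈ R → ∃ λ s → s ∈ R' × toℚ s ≡ α ℚ.* toℚ r ℚ.+ β
  backward r∈ with s , s∈ , gr≡fs ← ∈-map⁻ ⟦ f ⟧ (g⊆f (∈-map⁺ ⟦ g ⟧ r∈)) =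
    s , s∈ , inverse (sym gr≡fs)

containsCopy⇒image : ∀ {S M} → ContainsCopy S M → ∃ λ f → map ⟦ f ⟧ S ⊆ map +_ M
containsCopy⇒image {S} {M} (suc a-1 , _ , b , copy) = affine a-1 b , image
  where
  image : map ⟦ affine a-1 b ⟧ S ⊆ map +_ M
  image z∈ with s , s∈S , refl ← ∈-map⁻ _ z∈ with m , m∈M , m≡fs ← copy s s∈S =
    subst (_∈ map +_ M) m≡fs (∈-map⁺ +_ m∈M)

⟦⟧-image-unique : ∀ f {R} → AllPairs _<_ R → Unique (map ⟦ f ⟧ R)
⟦⟧-image-unique f sorted = Unique.map⁺ (⟦⟧-injective f) (sorted⇒unique sorted)

⟦⟧-image⊆⇒length-≤ : ∀ f {R T} → AllPairs _<_ R → map ⟦ f ⟧ R ⊆ map +_ T → length R ≤ length T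
⟦⟧-image⊆⇒length-≤ f {R} {T} sorted R⊆T = subst₂ _≤_ (length-map ⟦ f ⟧ R) (length-map +_ T)
  (unique-⊆⇒length-≤ (⟦⟧-image-unique f sorted) R⊆T)

⟦⟧-image⊆⇒⊇ : ∀ f {R T} → AllPairs _<_ R → map ⟦ f ⟧ R ⊆ map +_ T → length T ≤ length R →
              map +_ T ⊆ map ⟦ f ⟧ R
⟦⟧-image⊆⇒⊇ f {R} {T} sorted R⊆T T≤R =
  unique-⊆-length-≥⇒⊇ ℤ._≟_ (⟦⟧-image-unique f sorted) R⊆T
    (subst₂ _≤_ (sym (length-map +_ T)) (sym (length-map ⟦ f ⟧ R)) T≤R)

containsCopy⇒length-≤ : ∀ {S M} → AllPairs _<_ S → ContainsCopy S M → length S ≤ length M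
containsCopy⇒length-≤ sorted copy with f , S⊆M ← containsCopy⇒image copy =
  ⟦⟧-image⊆⇒length-≤ f sorted S⊆M

image-avoiding : ∀ {F : ℕ → ℤ} {R x T} → map F R ⊆ map +_ (x ∷ T) → (∀ {s} → s ∈ R → F s ≢ + x) →
                 map F R ⊆ map +_ T
image-avoiding {F} R⊆xT avoids z∈ with s , s∈R , refl ← ∈-map⁻ F z∈ with R⊆xT z∈
... | here Fs≡x  = contradiction Fs≡x (avoids s∈R)
... | there Fs∈T = Fs∈T

record Completion (S T : List ℕ) (x : ℕ) (i : Fin (length S)) : Set where
  field
    embedding : Affine
    hits      : ⟦ embedding ⟧ (lookup S i) ≡ + x
    image⊆    : map ⟦ embedding ⟧ (removeAt S i) ⊆ map +_ T
    image⊇    : map +_ T ⊆ map ⟦ embedding ⟧ (removeAt S i)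

open Completion

-- f(S) ⊆ x ∷ T consists of |S| = |x ∷ T| distinct numbers, so it contains x and fills T.
completion : ∀ {S T x} → AllPairs _<_ S → suc (length T) ≡ length S → ContainsCopy S (x ∷ T) →
             ∃ (Completion S T x)
completion {S} {T} {x} sorted |T|+1≡|S| copy with f , S⊆xT ← containsCopy⇒image copy
  with any? (λ s → ⟦ f ⟧ s ℤ.≟ + x) S
... | no x∉fS =
  contradiction (⟦⟧-image⊆⇒length-≤ f sorted S⊆T) (ℕₚ.<⇒≱ (ℕₚ.≤-reflexive |T|+1≡|S|))
  where
  S⊆T : map ⟦ f ⟧ S ⊆ map +_ T
  S⊆T = image-avoiding S⊆xT (λ s∈S fs≡x → x∉fS (lose s∈S fs≡x))
... | yes x∈fS = i , record
  { embedding = f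
  ; hits      = lookup-index x∈fS
  ; image⊆    = R⊆T
  ; image⊇    = ⟦⟧-image⊆⇒⊇ f (AllPairs-removeAt S i sorted) R⊆T (ℕₚ.≤-reflexive |T|≡|R|)
  }
  where
  i : Fin (length S)
  i = Any.index x∈fS
  R⊆T : map ⟦ f ⟧ (removeAt S i) ⊆ map +_ T
  R⊆T = image-avoiding (⊆-trans (⊆.map⁺ ⟦ f ⟧ (removeAt-⊆ S i)) S⊆xT) λ s∈R fs≡x →
    Unique-removeAt⇒≢lookup S i (sorted⇒unique sorted) s∈R
      (⟦⟧-injective f (trans fs≡x (sym (lookup-index x∈fS))))
  |T|≡|R| : length T ≡ length (removeAt S i)
  |T|≡|R| = ℕₚ.suc-injective (trans |T|+1≡|S| (length-removeAt′ S i))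

completions-same-position : ∀ {S T x x' i} → AllPairs _<_ S → 3 ≤ length S →
                            Completion S T x i → Completion S T x' i → x ≡ x'
completions-same-position {S} {x = x} {x'} {i} sorted 3≤|S| c c' = ℤₚ.+-injective (begin
  + x                              ≡⟨ sym (hits c) ⟩
  ⟦ embedding c ⟧ (lookup S i)     ≡⟨ cong (λ f → ⟦ f ⟧ (lookup S i)) f≡f' ⟩
  ⟦ embedding c' ⟧ (lookup S i)    ≡⟨ hits c' ⟩
  + x'                             ∎)
  where
  open ≡-Reasoning
  f≡f' : embedding c ≡ embedding c'
  f≡f' = ⟦⟧-same-image⇒≡ (embedding c) (embedding c') (AllPairs-removeAt S i sorted)
    (ℕ.s≤s⁻¹ (subst (3 ≤_) (length-removeAt′ S i) 3≤|S|))
    (⊆-trans (image⊆ c) (image⊇ c')) (⊆-trans (image⊆ c') (image⊇ c))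

completions⇒isCopy : ∀ {S T x x' i j} → Completion S T x i → Completion S T x' j →
                     IsCopy (removeAt S i) (removeAt S j)
completions⇒isCopy c c' = same-affine-image⇒isCopy (embedding c) (embedding c')
  (⊆-trans (image⊆ c) (image⊇ c')) (⊆-trans (image⊆ c') (image⊇ c))

fresh : (L : List ℕ) → ∃ λ y → y ∉ L
fresh L = suc (max 0 L) , λ y∈L → ℕₚ.1+n≰n (All.lookup (xs≤max 0 L) y∈L)

fresh-reply : ∀ x M B {P : ℕ → Set} → (∀ y → y ≢ x → y ∉ M → y ∉ B → P y) → ∃ P
fresh-reply x M B reply with y , y∉ ← fresh (x ∷ M ++ B) =
  y , reply y (y∉ ∘ here) (y∉ ∘ there ∘ ∈-++⁺ˡ) (y∉ ∘ there ∘ ∈-++⁺ʳ M)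

maker-moves : ∀ {S M B k} → AllPairs _<_ S → length M < length S → MakerWins S (suc k) M B →
  ∃ λ x → x ∉ M × x ∉ B × (∀ y → y ≢ x → y ∉ M → y ∉ B → MakerWins S k (x ∷ M) (y ∷ B))
maker-moves sorted |M|<|S| (inj₁ copy) =
  contradiction (containsCopy⇒length-≤ sorted copy) (ℕₚ.<⇒≱ |M|<|S|)
maker-moves sorted |M|<|S| (inj₂ move) = move

winning-move : ∀ {S M B} → AllPairs _<_ S → length M < length S → MakerWins S 1 M B →
  ∃ λ x → x ∉ M × x ∉ B × ContainsCopy S (x ∷ M)
winning-move {M = M} {B} sorted |M|<|S| wins =
  let x , x∉M , x∉B , reply = maker-moves {M = M} {B} {k = 0} sorted |M|<|S| wins
  in  x , x∉M , x∉B , proj₂ (fresh-reply x M B reply)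

record DoubleThreat (S : List ℕ) : Set where
  field
    position        : List ℕ
    length-position : suc (length position) ≡ length S
    move₁ move₂     : ℕ
    moves-distinct  : move₁ ≢ move₂
    wins₁           : ContainsCopy S (move₁ ∷ position)
    wins₂           : ContainsCopy S (move₂ ∷ position)

open DoubleThreat

-- Breaker first replies with a fresh number; replaying the same position, he instead takes
-- Maker's winning reply x, and Maker must still win, with some x' ≠ x.
last-two-moves : ∀ {S M B} → AllPairs _<_ S → suc (suc (length M)) ≡ length S →
                 MakerWins S 2 M B → DoubleThreat S
last-two-moves {S} {M} {B} sorted |M|+2≡|S| wins =
  let x₀ , _ , _ , reply      = maker-moves {M = M} {B} {k = 1} sorted |M|<|S| wins
      y , wins'               = fresh-reply x₀ M B reply
      x , x∉T , x∉yB , copy   = winning-move {M = x₀ ∷ M} {y ∷ B} sorted |M|+1<|S| wins'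
      x' , _ , x'∉xB , copy'  = winning-move {M = x₀ ∷ M} {x ∷ B} sorted |M|+1<|S|
                                  (reply x (x∉T ∘ here) (x∉T ∘ there) (x∉yB ∘ there))
  in record
    { position        = x₀ ∷ M
    ; length-position = |M|+2≡|S|
    ; move₁           = x
    ; move₂           = x'
    ; moves-distinct  = λ x≡x' → x'∉xB (here (sym x≡x'))
    ; wins₁           = copy
    ; wins₂           = copy'
    }
  where
  |M|+1<|S| : suc (length M) < length S
  |M|+1<|S| = ℕₚ.≤-reflexive |M|+2≡|S|
  |M|<|S| : length M < length S
  |M|<|S| = ℕₚ.<-trans (ℕₚ.n<1+n (length M)) |M|+1<|S|

breaker-delays : ∀ {S M B} → AllPairs _<_ S → ∀ k → suc (suc (length M + k)) ≡ length S →
                 MakerWins S (suc (suc k)) M B → DoubleThreat S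
breaker-delays {M = M} sorted zero len wins =
  last-two-moves sorted (trans (cong (λ n → suc (suc n)) (sym (ℕₚ.+-identityʳ (length M)))) len) wins
breaker-delays {S} {M} {B} sorted (suc k) len wins =
  let x , _ , _ , reply = maker-moves {M = M} {B} {k = suc (suc k)} sorted |M|<|S| wins
      y , wins'         = fresh-reply x M B reply
  in  breaker-delays sorted k (trans (cong (λ n → suc (suc n)) (sym (ℕₚ.+-suc (length M) k))) len) wins'
  where
  |M|<|S| : length M < length S
  |M|<|S| = subst (length M <_) len (ℕₚ.m<n⇒m<1+n (s≤s (ℕₚ.m≤m+n (length M) (suc k))))

doubleThreat⇒symmetric : ∀ {S} → AllPairs _<_ S → 3 ≤ length S → DoubleThreat S → Symmetric S
doubleThreat⇒symmetric sorted 3≤|S| threat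
  with i , c  ← completion sorted (length-position threat) (wins₁ threat)
  with j , c' ← completion sorted (length-position threat) (wins₂ threat)
  with Finₚ.<-cmp i j
... | tri< i<j _ _ = i , j , i<j , completions⇒isCopy c c'
... | tri> _ _ j<i = j , i , j<i , completions⇒isCopy c' c
... | tri≈ _ refl _ = contradiction (completions-same-position sorted 3≤|S| c c') (moves-distinct threat)

lemma3p3 : (S : List ℕ) → AllPairs _<_ S → 2 ≤ length S →
    HasStrategy S (length S) → Symmetric S
lemma3p3 (_ ∷ []) _ (s≤s ()) _
lemma3p3 (s₁ ∷ s₂ ∷ []) _ _ _ = zero , suc zero , z<s , isCopy-singleton s₂ s₁
lemma3p3 (_ ∷ _ ∷ _ ∷ rest) sorted _ strategy =
  doubleThreat⇒symmetric sorted (s≤s (s≤s (s≤s z≤n)))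
    (breaker-delays sorted (suc (length rest)) refl strategy)
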